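{- If $\phi_1:A_1\leftrightarrow B_1,\dots,\phi_n:A_n\leftrightarrow B_n\vdash_\omega\omega:T$, then $\phi_1:B_1\leftrightarrow A_1,\dots,\phi_n:B_n\leftrightarrow A_n\vdash_\omega\omega^{ -1}:T^{ -1}$.
   Context: The language. Base types $A,B ::= \mathbb{1} \mid A\oplus B\mid A\otimes B\mid \mu X.A\mid X$; iso types $T::=A\leftrightarrow B\mid T_1\to T_2$. Values $v::=()\mid x\mid \mathtt{inl}\,v\mid\mathtt{inr}\,v\mid\langle v_1,v_2\rangle\mid \mathtt{fold}\,v$; patterns $p::=x\mid\langle p_1,p_2\rangle$; expressions $e::=v\mid \mathtt{let}\,p_1=\omega\,p_2\,\mathtt{in}\,e$; isos $\omega::=\{v_1\leftrightarrow e_1\mid\dots\mid v_n\leftrightarrow e_n\}\mid \mathtt{fix}\,\phi.\omega\mid\lambda\phi.\omega\mid\phi\mid\omega_1\omega_2$; terms $t::=()\mid x\mid\mathtt{inl}\,t\mid\mathtt{inr}\,t\mid\langle t_1,t_2\rangle\mid\mathtt{fold}\,t\mid\omega\,t\mid\mathtt{let}\,p=t_1\,\mathtt{in}\,t_2$. Typing rules for terms ($\Delta$ linear, $\Psi$ non-linear): $()$:$\mathbb{1}$ in empty $\Delta$; $x:A\vdash x:A$; $\mathtt{inl},\mathtt{inr}$ into $A\oplus B$; pairs split $\Delta$; $\mathtt{fold}\,t:\mu X.A$ if $t:A[\mu X.A/X]$; $\omega\,t:B$ if $\Psi\vdash_\omega\omega:A\leftrightarrow B$ and $t:A$; $\Psi;\Delta_1,\Delta_2\vdash\mathtt{let}\,(x_1,\dots,x_n)=t_1\,\mathtt{in}\,t_2:B$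 if $\Psi;\Delta_1\vdash t_1:A_1\otimes\dots\otimes A_n$ and $\Psi;\Delta_2,x_1:A_1,\dots,x_n:A_n\vdash t_2:B$. Iso rules: $\Psi,\phi:T\vdash_\omega\phi:T$; $\mathtt{fix}\,\phi.\omega:T$ if $\Psi,\phi:T\vdash_\omega\omega:T$; $\omega_2\omega_1:T_2$ if $\omega_1:T_1$, $\omega_2:T_1\to T_2$; $\lambda\phi.\omega:T_1\to T_2$ if $\Psi,\phi:T_1\vdash_\omega\omega:T_2$; $\{v_i\leftrightarrow e_i\}_i:A\leftrightarrow B$ if for each $i$, $\Psi;\Delta_i\vdash v_i:A$, $\Psi;\Delta_i\vdash e_i:B$, and $v_i\perp v_j$, $e_i\perp e_j$ for $i\ne j$, with orthogonality $\perp$ the smallest relation having $\mathtt{inl}\,t_1\perp\mathtt{inr}\,t_2$, $\mathtt{inr}\,t_1\perp\mathtt{inl}\,t_2$, and $C[t_1]\perp C[t_2]$ when $t_1\perp t_2$ for $C::=[-]\mid\mathtt{inl}\,C\mid\mathtt{inr}\,C\mid\langle C,t\rangle\mid\langle t,C\rangle\mid\mathtt{fold}\,C\mid\mathtt{let}\,p=t\,\mathtt{in}\,C$. Inversion: $(A\leftrightarrow B)^{ -1}=B\leftrightarrow A$, $(T_1\to T_2)^{ -1}=T_1^{ -1}\to T_2^{ -1}$; $\phi^{ -1}=\phi$; $(\mathtt{fix}\,\phi.\omega)^{ -1}=\mathtt{fix}\,\phi.\omega^{ -1}$; $(\omega_1\omega_2)^{ -1}=\omega_1^{ -1}\omega_2^{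 -1}$; $(\lambda\phi.\omega)^{ -1}=\lambda\phi.\omega^{ -1}$; a clause-set is inverted clause by clause, with $(v\leftrightarrow\mathtt{let}\,p_1=\omega_1\,p_1'\,\mathtt{in}\cdots\mathtt{let}\,p_n=\omega_n\,p_n'\,\mathtt{in}\,v')^{ -1}=(v'\leftrightarrow\mathtt{let}\,p_n'=\omega_n^{ -1}\,p_n\,\mathtt{in}\cdots\mathtt{let}\,p_1'=\omega_1^{ -1}\,p_1\,\mathtt{in}\,v)$. -}

module Defs where

open import Data.Nat using (ℕ; zero; suc)
open import Data.Fin using (Fin)
open import Data.List using (List; []; _∷_; _++_; length; lookup; map)
open import Data.List.Relation.Unary.All using (All)
open import Data.List.Relation.Ternary.Interleaving.Propositional using (Interleaving)
open import Data.Product using (Σ; _×_; _,_)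
open import Relation.Binary.PropositionalEquality using (_≡_; _≢_)

-- Base types  A,B ::= 1 | A ⊕ B | A ⊗ B | μX.A | X
-- Type variables are de Bruijn indices; μ binds index 0.

infixr 6 _⊕_
infixr 7 _⊗_

data Ty : Set where
  𝟙    : Ty
  _⊕_  : Ty → Ty → Ty
  _⊗_  : Ty → Ty → Ty
  μ    : Ty → Ty
  tvar : ℕ → Ty

extR : (ℕ → ℕ) → ℕ → ℕ
extR ρ zero    = zero
extR ρ (suc n) = suc (ρ n)

rename : (ℕ → ℕ) → Ty → Ty
rename ρ 𝟙        = 𝟙
rename ρ (A ⊕ B)  = rename ρ A ⊕ rename ρ B
rename ρ (A ⊗ B)  = rename ρ A ⊗ rename ρ B
rename ρ (μ A)    = μ (rename (extR ρ) A)
rename ρ (tvar n) = tvar (ρ n)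

extS : (ℕ → Ty) → ℕ → Ty
extS σ zero    = tvar zero
extS σ (suc n) = rename suc (σ n)

substTy : (ℕ → Ty) → Ty → Ty
substTy σ 𝟙        = 𝟙
substTy σ (A ⊕ B)  = substTy σ A ⊕ substTy σ B
substTy σ (A ⊗ B)  = substTy σ A ⊗ substTy σ B
substTy σ (μ A)    = μ (substTy (extS σ) A)
substTy σ (tvar n) = σ n

sub0 : Ty → ℕ → Ty
sub0 B zero    = B
sub0 B (suc n) = tvar n

_[_]₀ : Ty → Ty → Ty
A [ B ]₀ = substTy (sub0 B) A

infixr 4 _↔_
infixr 3 _⇒_

data ITy : Set where
  _↔_ : Ty → Ty → ITy
  _⇒_ : ITy → ITy → ITy

Var : Set
Var = ℕ

IVar : Set
IVar = ℕ

data Pat : Set where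
  pvar  : Var → Pat
  ppair : Pat → Pat → Pat

data Val : Set where
  vunit : Val
  vvar  : Var → Val
  vinl  : Val → Val
  vinr  : Val → Val
  vpair : Val → Val → Val
  vfold : Val → Val

mutual
  data Expr : Set where
    eval : Val → Expr
    elet : Pat → Iso → Pat → Expr → Expr

  data Clause : Set where
    _⟷_ : Val → Expr → Clause

  data Iso : Set where
    clauses : List Clause → Iso
    ifix    : IVar → Iso → Iso
    ilam    : IVar → Iso → Iso
    ivar    : IVar → Iso
    iapp    : Iso → Iso → Iso

data Term : Set where
  tunit : Term
  tvr   : Var → Term
  tinl  : Term → Term
  tinr  : Term → Term
  tpair : Term → Term → Term
  tfold : Term → Term
  tapp  : Iso → Term → Term
  tlet  : Pat → Term → Term → Term

patV : Pat → Val
patV (pvar x)      = vvar x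
patV (ppair p₁ p₂) = vpair (patV p₁) (patV p₂)

valT : Val → Term
valT vunit         = tunit
valT (vvar x)      = tvr x
valT (vinl v)      = tinl (valT v)
valT (vinr v)      = tinr (valT v)
valT (vpair v₁ v₂) = tpair (valT v₁) (valT v₂)
valT (vfold v)     = tfold (valT v)

patT : Pat → Term
patT p = valT (patV p)

exprT : Expr → Term
exprT (eval v)          = valT v
exprT (elet p₁ ω p₂ e)  = tlet p₁ (tapp ω (patT p₂)) (exprT e)

data Ctx : Set where
  hole  : Ctx
  cinl  : Ctx → Ctx
  cinr  : Ctx → Ctx
  cpairL : Ctx → Term → Ctx
  cpairR : Term → Ctx → Ctx
  cfold : Ctx → Ctx
  clet  : Pat → Term → Ctx → Ctx

plug : Ctx → Term → Term
plug hole          t = t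
plug (cinl C)      t = tinl (plug C t)
plug (cinr C)      t = tinr (plug C t)
plug (cpairL C t') t = tpair (plug C t) t'
plug (cpairR t' C) t = tpair t' (plug C t)
plug (cfold C)     t = tfold (plug C t)
plug (clet p t' C) t = tlet p t' (plug C t)

infix 4 _⊥_

data _⊥_ : Term → Term → Set where
  inl⊥inr : ∀ t₁ t₂ → tinl t₁ ⊥ tinr t₂
  inr⊥inl : ∀ t₁ t₂ → tinr t₁ ⊥ tinl t₂
  ctx⊥    : ∀ C {t₁ t₂} → t₁ ⊥ t₂ → plug C t₁ ⊥ plug C t₂

-- Contexts.  Ψ : non-linear iso context (most recent binding first,
-- lookup respects shadowing);  Δ : linear term context, split by
-- interleaving (i.e. contexts are taken up to exchange).

ICtx : Set
ICtx = List (IVar × ITy)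

LCtx : Set
LCtx = List (Var × Ty)

infix 4 _∋_∶_

data _∋_∶_ : ICtx → IVar → ITy → Set where
  here  : ∀ {Ψ φ T} → ((φ , T) ∷ Ψ) ∋ φ ∶ T
  there : ∀ {Ψ φ ψ T U} → φ ≢ ψ → Ψ ∋ φ ∶ T → ((ψ , U) ∷ Ψ) ∋ φ ∶ T

data PatTy : Pat → Ty → LCtx → Set where
  pvarTy  : ∀ {x A} → PatTy (pvar x) A ((x , A) ∷ [])
  ppairTy : ∀ {p₁ p₂ A B Γ₁ Γ₂} → PatTy p₁ A Γ₁ → PatTy p₂ B Γ₂ →
            PatTy (ppair p₁ p₂) (A ⊗ B) (Γ₁ ++ Γ₂)

infix 3 _⨾_⊢_∶_ _⊢ω_∶_

mutual
  data _⨾_⊢_∶_ : ICtx → LCtx → Term → Ty → Set where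
    unitTy : ∀ {Ψ} → Ψ ⨾ [] ⊢ tunit ∶ 𝟙
    varTy  : ∀ {Ψ x A} → Ψ ⨾ ((x , A) ∷ []) ⊢ tvr x ∶ A
    inlTy  : ∀ {Ψ Δ t A B} → Ψ ⨾ Δ ⊢ t ∶ A → Ψ ⨾ Δ ⊢ tinl t ∶ A ⊕ B
    inrTy  : ∀ {Ψ Δ t A B} → Ψ ⨾ Δ ⊢ t ∶ B → Ψ ⨾ Δ ⊢ tinr t ∶ A ⊕ B
    pairTy : ∀ {Ψ Δ Δ₁ Δ₂ t₁ t₂ A B} → Interleaving Δ₁ Δ₂ Δ →
             Ψ ⨾ Δ₁ ⊢ t₁ ∶ A → Ψ ⨾ Δ₂ ⊢ t₂ ∶ B → Ψ ⨾ Δ ⊢ tpair t₁ t₂ ∶ A ⊗ B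
    foldTy : ∀ {Ψ Δ t A} → Ψ ⨾ Δ ⊢ t ∶ A [ μ A ]₀ → Ψ ⨾ Δ ⊢ tfold t ∶ μ A
    appTy  : ∀ {Ψ Δ ω t A B} → Ψ ⊢ω ω ∶ (A ↔ B) → Ψ ⨾ Δ ⊢ t ∶ A → Ψ ⨾ Δ ⊢ tapp ω t ∶ B
    letTy  : ∀ {Ψ Δ Δ₁ Δ₂ Γ p t₁ t₂ A B} → Interleaving Δ₁ Δ₂ Δ →
             Ψ ⨾ Δ₁ ⊢ t₁ ∶ A → PatTy p A Γ → Ψ ⨾ (Δ₂ ++ Γ) ⊢ t₂ ∶ B →
             Ψ ⨾ Δ ⊢ tlet p t₁ t₂ ∶ B

  data _⊢ω_∶_ : ICtx → Iso → ITy → Set where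
    ivarTy : ∀ {Ψ φ T} → Ψ ∋ φ ∶ T → Ψ ⊢ω ivar φ ∶ T
    fixTy  : ∀ {Ψ φ ω T} → ((φ , T) ∷ Ψ) ⊢ω ω ∶ T → Ψ ⊢ω ifix φ ω ∶ T
    appωTy : ∀ {Ψ ω₁ ω₂ T₁ T₂} → Ψ ⊢ω ω₁ ∶ T₁ → Ψ ⊢ω ω₂ ∶ (T₁ ⇒ T₂) →
             Ψ ⊢ω iapp ω₂ ω₁ ∶ T₂
    lamTy  : ∀ {Ψ φ ω T₁ T₂} → ((φ , T₁) ∷ Ψ) ⊢ω ω ∶ T₂ → Ψ ⊢ω ilam φ ω ∶ (T₁ ⇒ T₂)
    clsTy  : ∀ {Ψ A B} (cs : List Clause) →
             All (λ { (v ⟷ e) → Σ LCtx λ Δ →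
                        (Ψ ⨾ Δ ⊢ valT v ∶ A) × (Ψ ⨾ Δ ⊢ exprT e ∶ B) }) cs →
             (∀ (i j : Fin (length cs)) → i ≢ j → lhsT (lookup cs i) ⊥ lhsT (lookup cs j)) →
             (∀ (i j : Fin (length cs)) → i ≢ j → rhsT (lookup cs i) ⊥ rhsT (lookup cs j)) →
             Ψ ⊢ω clauses cs ∶ (A ↔ B)

  lhsT : Clause → Term
  lhsT (v ⟷ e) = valT v

  rhsT : Clause → Term
  rhsT (v ⟷ e) = exprT e

invT : ITy → ITy
invT (A ↔ B)   = B ↔ A
invT (T₁ ⇒ T₂) = invT T₁ ⇒ invT T₂

mutual
  inv : Iso → Iso
  inv (clauses cs) = clauses (invCls cs)
  inv (ifix φ ω)   = ifix φ (inv ω)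
  inv (ilam φ ω)   = ilam φ (inv ω)
  inv (ivar φ)     = ivar φ
  inv (iapp ω₁ ω₂) = iapp (inv ω₁) (inv ω₂)

  invCls : List Clause → List Clause
  invCls []             = []
  invCls ((v ⟷ e) ∷ cs) = invClause e (eval v) ∷ invCls cs

  -- (v ↔ let p₁ = ω₁ p₁' in … let pₙ = ωₙ pₙ' in v')⁻¹
  --   = v' ↔ let pₙ' = ωₙ⁻¹ pₙ in … let p₁' = ω₁⁻¹ p₁ in v
  -- invClause e acc walks e, prepending the inverted lets onto acc.
  invClause : Expr → Expr → Clause
  invClause (eval v')        acc = v' ⟷ acc
  invClause (elet p ω p' e)  acc = invClause e (elet p' (inv ω) p acc)

isoCtx : List (IVar × Ty × Ty) → ICtx
isoCtx []                  = []
isoCtx ((φ , A , B) ∷ Φ)   = (φ , (A ↔ B)) ∷ isoCtx Φ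

isoCtxInv : List (IVar × Ty × Ty) → ICtx
isoCtxInv []                = []
isoCtxInv ((φ , A , B) ∷ Φ) = (φ , (B ↔ A)) ∷ isoCtxInv Φ

-- The only non-congruence case of the induction on typing is a clause
-- v ↔ let p₁ = ω₁ p₁' in … v': reading the lets backwards, each let pᵢ' = ωᵢ⁻¹ pᵢ consumes exactly the variables its forward counterpart produced,
-- so the reversed expression is typed in the same linear context up to permutation.
-- Orthogonality survives because two orthogonal expressions share their leading lets up to
-- the point where they diverge, so after reversal they share a common let-prefix.
module Submission where

open import Defs
open import Data.List using (List; []; _∷_; _++_; lookup; map)
open import Data.List.Relation.Unary.All as All using (All; []; _∷_)
import Data.List.Relation.Binary.Pointwise as Pointwise
open import Data.List.Relation.Ternary.Interleaving using (left; right)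
  renaming (swap to Interleaving-swap)
open import Data.List.Relation.Ternary.Interleaving.Properties using (++-disjoint)
open import Data.List.Relation.Ternary.Interleaving.Propositional
  using (Interleaving; consˡ; consʳ; toPermutation)
open import Data.List.Relation.Binary.Permutation.Propositional
  using (_↭_; refl; prep; swap; trans; ↭-sym; ↭-trans; module PermutationReasoning)
open import Data.List.Relation.Binary.Permutation.Propositional.Properties
  using (↭-empty-inv; ↭-singleton-inv; ++⁺; ++⁺ˡ; ++⁺ʳ; ++-comm)
open import Data.Product using (Σ; ∃₂; _×_; _,_)
open import Data.List.Properties using (length-map)
open import Data.Fin using (zero; suc; cast)
open import Data.Fin.Properties using (cast-involutive)
open import Data.Empty using (⊥-elim)
open import Function using (_∘_)
open import Relation.Binary.PropositionalEquality
  using (_≡_; _≢_; refl; sym; cong; subst; subst₂; module ≡-Reasoning)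

invCtx : ICtx → ICtx
invCtx []            = []
invCtx ((φ , T) ∷ Ψ) = (φ , invT T) ∷ invCtx Ψ

invCtx-isoCtx : ∀ Φ → invCtx (isoCtx Φ) ≡ isoCtxInv Φ
invCtx-isoCtx []                = refl
invCtx-isoCtx ((φ , A , B) ∷ Φ) = cong ((φ , (B ↔ A)) ∷_) (invCtx-isoCtx Φ)

∋-invCtx : ∀ {Ψ φ T} → Ψ ∋ φ ∶ T → invCtx Ψ ∋ φ ∶ invT T
∋-invCtx here          = here
∋-invCtx (there φ≢ψ φ∈) = there φ≢ψ (∋-invCtx φ∈)

module _ {a} {A : Set a} where

  interleaving-++ : ∀ (l r : List A) → Interleaving l r (l ++ r)
  interleaving-++ l r =
    ++-disjoint (left (Pointwise.refl refl)) (right (Pointwise.refl refl))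

  interleaving-↭ : ∀ {l r xs ys : List A} → Interleaving l r xs → xs ↭ ys →
                   ∃₂ λ l' r' → l ↭ l' × r ↭ r' × Interleaving l' r' ys
  interleaving-↭ I refl = _ , _ , refl , refl , I
  interleaving-↭ (consˡ I) (prep x p) with interleaving-↭ I p
  ... | _ , _ , l↭ , r↭ , J = _ , _ , prep x l↭ , r↭ , consˡ J
  interleaving-↭ (consʳ I) (prep x p) with interleaving-↭ I p
  ... | _ , _ , l↭ , r↭ , J = _ , _ , l↭ , prep x r↭ , consʳ J
  interleaving-↭ (consˡ (consˡ I)) (swap x y p) with interleaving-↭ I p
  ... | _ , _ , l↭ , r↭ , J = _ , _ , swap x y l↭ , r↭ , consˡ (consˡ J)
  interleaving-↭ (consˡ (consʳ I)) (swap x y p) with interleaving-↭ I p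
  ... | _ , _ , l↭ , r↭ , J = _ , _ , prep x l↭ , prep y r↭ , consʳ (consˡ J)
  interleaving-↭ (consʳ (consˡ I)) (swap x y p) with interleaving-↭ I p
  ... | _ , _ , l↭ , r↭ , J = _ , _ , prep y l↭ , prep x r↭ , consˡ (consʳ J)
  interleaving-↭ (consʳ (consʳ I)) (swap x y p) with interleaving-↭ I p
  ... | _ , _ , l↭ , r↭ , J = _ , _ , l↭ , swap x y r↭ , consʳ (consʳ J)
  interleaving-↭ I (trans p q) with interleaving-↭ I p
  ... | _ , _ , l↭ , r↭ , J with interleaving-↭ J q
  ... | _ , _ , l↭' , r↭' , K = _ , _ , ↭-trans l↭ l↭' , ↭-trans r↭ r↭' , K

DistinctLookups : ∀ {a r} {A : Set a} → (A → A → Set r) → List A → Set r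
DistinctLookups R xs = ∀ i j → i ≢ j → R (lookup xs i) (lookup xs j)

module _ {a b} {A : Set a} {B : Set b} (f : A → B) where

  lookup-map : ∀ xs i → lookup (map f xs) i ≡ f (lookup xs (cast (length-map f xs) i))
  lookup-map (x ∷ xs) zero    = refl
  lookup-map (x ∷ xs) (suc i) = lookup-map xs i

  DistinctLookups-map⁺ : ∀ {r s} {R : A → A → Set r} {S : B → B → Set s} →
                         (∀ {x y} → R x y → S (f x) (f y)) →
                         ∀ {xs} → DistinctLookups R xs → DistinctLookups S (map f xs)
  DistinctLookups-map⁺ {S = S} f-pres {xs} R-xs i j i≢j =
    subst₂ S (sym (lookup-map xs i)) (sym (lookup-map xs j))
      (f-pres (R-xs (cast eq i) (cast eq j) (i≢j ∘ cast-injective)))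
    where
    eq = length-map f xs
    cast-injective : ∀ {k l} → cast eq k ≡ cast eq l → k ≡ l
    cast-injective {k} {l} castk≡castl = begin
      k                          ≡⟨ sym (cast-involutive (sym eq) eq k) ⟩
      cast (sym eq) (cast eq k)  ≡⟨ cong (cast (sym eq)) castk≡castl ⟩
      cast (sym eq) (cast eq l)  ≡⟨ cast-involutive (sym eq) eq l ⟩
      l                          ∎
      where open ≡-Reasoning

⊢-↭ : ∀ {Ψ Δ Δ' t A} → Ψ ⨾ Δ ⊢ t ∶ A → Δ ↭ Δ' → Ψ ⨾ Δ' ⊢ t ∶ A
⊢-↭ unitTy p with ↭-empty-inv (↭-sym p)
... | refl = unitTy
⊢-↭ varTy p with ↭-singleton-inv (↭-sym p)
... | refl = varTy
⊢-↭ (inlTy ⊢t) p = inlTy (⊢-↭ ⊢t p)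
⊢-↭ (inrTy ⊢t) p = inrTy (⊢-↭ ⊢t p)
⊢-↭ (pairTy I ⊢t₁ ⊢t₂) p with interleaving-↭ I p
... | _ , _ , p₁ , p₂ , J = pairTy J (⊢-↭ ⊢t₁ p₁) (⊢-↭ ⊢t₂ p₂)
⊢-↭ (foldTy ⊢t) p = foldTy (⊢-↭ ⊢t p)
⊢-↭ (appTy ⊢ω ⊢t) p = appTy ⊢ω (⊢-↭ ⊢t p)
⊢-↭ (letTy {Γ = Γ} I ⊢t₁ p∶Γ ⊢t₂) p with interleaving-↭ I p
... | _ , _ , p₁ , p₂ , J = letTy J (⊢-↭ ⊢t₁ p₁) p∶Γ (⊢-↭ ⊢t₂ (++⁺ʳ Γ p₂))

PatTy⇒⊢patT : ∀ {Ψ p A Γ} → PatTy p A Γ → Ψ ⨾ Γ ⊢ patT p ∶ A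
PatTy⇒⊢patT pvarTy = varTy
PatTy⇒⊢patT (ppairTy {Γ₁ = Γ₁} {Γ₂ = Γ₂} p₁∶Γ₁ p₂∶Γ₂) =
  pairTy (interleaving-++ Γ₁ Γ₂) (PatTy⇒⊢patT p₁∶Γ₁) (PatTy⇒⊢patT p₂∶Γ₂)

⊢patT⇒PatTy : ∀ {Ψ Δ A} p → Ψ ⨾ Δ ⊢ patT p ∶ A → Σ LCtx λ Γ → PatTy p A Γ × Γ ↭ Δ
⊢patT⇒PatTy (pvar x) varTy = _ , pvarTy , refl
⊢patT⇒PatTy (ppair p₁ p₂) (pairTy I ⊢p₁ ⊢p₂)
  with ⊢patT⇒PatTy p₁ ⊢p₁ | ⊢patT⇒PatTy p₂ ⊢p₂
... | _ , p₁∶Γ₁ , Γ₁↭ | _ , p₂∶Γ₂ , Γ₂↭ =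
  _ , ppairTy p₁∶Γ₁ p₂∶Γ₂ , ↭-trans (++⁺ Γ₁↭ Γ₂↭) (↭-sym (toPermutation I))

⊢valT-ICtx-irrelevant : ∀ {Ψ Ψ' Δ A} v → Ψ ⨾ Δ ⊢ valT v ∶ A → Ψ' ⨾ Δ ⊢ valT v ∶ A
⊢valT-ICtx-irrelevant vunit         unitTy           = unitTy
⊢valT-ICtx-irrelevant (vvar x)      varTy            = varTy
⊢valT-ICtx-irrelevant (vinl v)      (inlTy ⊢v)       = inlTy (⊢valT-ICtx-irrelevant v ⊢v)
⊢valT-ICtx-irrelevant (vinr v)      (inrTy ⊢v)       = inrTy (⊢valT-ICtx-irrelevant v ⊢v)
⊢valT-ICtx-irrelevant (vpair v₁ v₂) (pairTy I ⊢v₁ ⊢v₂) =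
  pairTy I (⊢valT-ICtx-irrelevant v₁ ⊢v₁) (⊢valT-ICtx-irrelevant v₂ ⊢v₂)
⊢valT-ICtx-irrelevant (vfold v)     (foldTy ⊢v)      = foldTy (⊢valT-ICtx-irrelevant v ⊢v)

⊥-sym : ∀ {t u} → t ⊥ u → u ⊥ t
⊥-sym (inl⊥inr t₁ t₂) = inr⊥inl t₂ t₁
⊥-sym (inr⊥inl t₁ t₂) = inl⊥inr t₂ t₁
⊥-sym (ctx⊥ C t⊥u)    = ctx⊥ C (⊥-sym t⊥u)

⊥-tlet⁻ : ∀ {p t b u} → tlet p t b ⊥ u → Σ Term λ b' → u ≡ tlet p t b' × b ⊥ b'
⊥-tlet⁻ o = go o refl
  where
  -- plug is not a constructor, so the derivation cannot be matched against tlet directly.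
  go : ∀ {p t b t₁ u} → t₁ ⊥ u → t₁ ≡ tlet p t b → Σ Term λ b' → u ≡ tlet p t b' × b ⊥ b'
  go (ctx⊥ hole o)         eq   = go o eq
  go (ctx⊥ (clet _ _ C) o) refl = _ , refl , ctx⊥ C o
  go (inl⊥inr _ _)         ()
  go (inr⊥inl _ _)         ()
  go (ctx⊥ (cinl _) _)     ()
  go (ctx⊥ (cinr _) _)     ()
  go (ctx⊥ (cpairL _ _) _) ()
  go (ctx⊥ (cpairR _ _) _) ()
  go (ctx⊥ (cfold _) _)    ()

valT≢tlet : ∀ {p t b} v → valT v ≢ tlet p t b
valT≢tlet vunit       ()
valT≢tlet (vvar _)    ()
valT≢tlet (vinl _)    ()
valT≢tlet (vinr _)    ()
valT≢tlet (vpair _ _) ()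
valT≢tlet (vfold _)   ()

tpair-injective : ∀ {t₁ t₂ u₁ u₂} → tpair t₁ t₂ ≡ tpair u₁ u₂ → t₁ ≡ u₁ × t₂ ≡ u₂
tpair-injective refl = refl , refl

patT-injective : ∀ p q → patT p ≡ patT q → p ≡ q
patT-injective (pvar x)      (pvar .x)     refl = refl
patT-injective (pvar _)      (ppair _ _)   ()
patT-injective (ppair _ _)   (pvar _)      ()
patT-injective (ppair p₁ p₂) (ppair q₁ q₂) eq with tpair-injective eq
... | eq₁ , eq₂ rewrite patT-injective p₁ q₁ eq₁ | patT-injective p₂ q₂ eq₂ = refl

tlet-tapp-injective : ∀ {p q ω ω' t t' b b'} → tlet p (tapp ω t) b ≡ tlet q (tapp ω' t') b' →
                      p ≡ q × ω ≡ ω' × t ≡ t' × b ≡ b'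
tlet-tapp-injective refl = refl , refl , refl , refl

⊥-elet⁻ : ∀ {p ω p' e₁ e₂} → exprT (elet p ω p' e₁) ⊥ exprT e₂ →
          Σ Expr λ e₂' → e₂ ≡ elet p ω p' e₂' × exprT e₁ ⊥ exprT e₂'
⊥-elet⁻ {e₂ = eval v} o with ⊥-tlet⁻ o
... | _ , eq , _ = ⊥-elim (valT≢tlet v eq)
⊥-elet⁻ {p' = p'} {e₂ = elet q ω₂ q' e₂'} o with ⊥-tlet⁻ o
... | _ , eq , o' with tlet-tapp-injective eq
... | refl , refl , q'≡p' , refl with patT-injective q' p' q'≡p'
... | refl = e₂' , refl , o'

infix 4 _⊥ᶜ_

record _⊥ᶜ_ (c₁ c₂ : Clause) : Set where
  constructor _,_
  field
    lhs⊥ : lhsT c₁ ⊥ lhsT c₂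
    rhs⊥ : rhsT c₁ ⊥ rhsT c₂

open _⊥ᶜ_

invClause-⊥ : ∀ e₁ e₂ {acc₁ acc₂} → exprT e₁ ⊥ exprT e₂ → exprT acc₁ ⊥ exprT acc₂ →
              invClause e₁ acc₁ ⊥ᶜ invClause e₂ acc₂
invClause-⊥ (eval _) (eval _) o oacc = o , oacc
invClause-⊥ (eval v) (elet p ω p' e) o oacc with ⊥-elet⁻ {p} {ω} {p'} {e} {eval v} (⊥-sym o)
... | _ , () , _
invClause-⊥ (elet p ω p' e₁) e₂ o oacc with ⊥-elet⁻ {p} {ω} {p'} {e₁} {e₂} o
... | e₂' , refl , o' =
  invClause-⊥ e₁ e₂' o' (ctx⊥ (clet p' (tapp (inv ω) (patT p)) hole) oacc)

invertClause : Clause → Clause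
invertClause (v ⟷ e) = invClause e (eval v)

invCls≡map-invertClause : ∀ cs → invCls cs ≡ map invertClause cs
invCls≡map-invertClause []                = refl
invCls≡map-invertClause (c@(_ ⟷ _) ∷ cs) = cong (invertClause c ∷_) (invCls≡map-invertClause cs)

invertClause-⊥ᶜ : ∀ {c₁ c₂} → c₁ ⊥ᶜ c₂ → invertClause c₁ ⊥ᶜ invertClause c₂
invertClause-⊥ᶜ {v₁ ⟷ e₁} {v₂ ⟷ e₂} (v₁⊥v₂ , e₁⊥e₂) = invClause-⊥ e₁ e₂ e₁⊥e₂ v₁⊥v₂

WellTypedClause : ICtx → Ty → Ty → Clause → Set
WellTypedClause Ψ A B (v ⟷ e) = Σ LCtx λ Δ → Ψ ⨾ Δ ⊢ valT v ∶ A × Ψ ⨾ Δ ⊢ exprT e ∶ B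

-- The recursion is structural in ω (through clauses and lets), not in the derivation,
-- which is rebuilt by All.map on the way.
mutual
  ⊢ω-inv : ∀ {Ψ T} ω → Ψ ⊢ω ω ∶ T → invCtx Ψ ⊢ω inv ω ∶ invT T
  ⊢ω-inv (ivar φ)     (ivarTy φ∈)        = ivarTy (∋-invCtx φ∈)
  ⊢ω-inv (ifix φ ω)   (fixTy ⊢ω)         = fixTy (⊢ω-inv ω ⊢ω)
  ⊢ω-inv (ilam φ ω)   (lamTy ⊢ω)         = lamTy (⊢ω-inv ω ⊢ω)
  ⊢ω-inv (iapp ω₂ ω₁) (appωTy ⊢ω₁ ⊢ω₂)   = appωTy (⊢ω-inv ω₁ ⊢ω₁) (⊢ω-inv ω₂ ⊢ω₂)
  -- λ { {_ ⟷ _} d → d } converts between clsTy's anonymous clause predicate and WellTypedClause.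
  ⊢ω-inv (clauses cs) (clsTy _ typed vs⊥ es⊥) rewrite invCls≡map-invertClause cs =
    clsTy _ (All.map (λ { {_ ⟷ _} d → d })
                     (All-invertClause cs (All.map (λ { {_ ⟷ _} d → d }) typed)))
          (λ i j → lhs⊥ ∘ inverted⊥ i j) (λ i j → rhs⊥ ∘ inverted⊥ i j)
    where
    inverted⊥ : DistinctLookups _⊥ᶜ_ (map invertClause cs)
    inverted⊥ =
      DistinctLookups-map⁺ invertClause {R = _⊥ᶜ_} {S = _⊥ᶜ_} invertClause-⊥ᶜ {cs}
        λ i j i≢j → vs⊥ i j i≢j , es⊥ i j i≢j

  All-invertClause : ∀ {Ψ A B} cs → All (WellTypedClause Ψ A B) cs →
                     All (WellTypedClause (invCtx Ψ) B A) (map invertClause cs)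
  All-invertClause []             []                   = []
  All-invertClause ((v ⟷ e) ∷ cs) ((_ , ⊢v , ⊢e) ∷ typed) =
    invClause-typed e ⊢e (⊢valT-ICtx-irrelevant v ⊢v) ∷ All-invertClause cs typed

  invClause-typed : ∀ {Ψ Δ A B} e {acc} → Ψ ⨾ Δ ⊢ exprT e ∶ B → invCtx Ψ ⨾ Δ ⊢ exprT acc ∶ A →
                    WellTypedClause (invCtx Ψ) B A (invClause e acc)
  invClause-typed (eval v') ⊢v' ⊢acc = _ , ⊢valT-ICtx-irrelevant v' ⊢v' , ⊢acc
  invClause-typed {Δ = Δ} (elet p ω p' e)
                  (letTy {Δ₁ = Δ₁} {Δ₂ = Δ₂} {Γ = Γ} I (appTy ⊢ω ⊢p') p∶Γ ⊢e) ⊢acc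
    with ⊢patT⇒PatTy p' ⊢p'
  ... | Γ' , p'∶Γ' , Γ'↭Δ₁ =
    invClause-typed e ⊢e
      (letTy (Interleaving-swap (interleaving-++ Δ₂ Γ))
             (appTy (⊢ω-inv ω ⊢ω) (PatTy⇒⊢patT p∶Γ)) p'∶Γ' (⊢-↭ ⊢acc Δ↭Δ₂++Γ'))
    where
    open PermutationReasoning
    Δ↭Δ₂++Γ' : Δ ↭ Δ₂ ++ Γ'
    Δ↭Δ₂++Γ' = begin
      Δ         ↭⟨ toPermutation I ⟩
      Δ₁ ++ Δ₂  ↭⟨ ++-comm Δ₁ Δ₂ ⟩
      Δ₂ ++ Δ₁  ↭⟨ ++⁺ˡ Δ₂ (↭-sym Γ'↭Δ₁) ⟩
      Δ₂ ++ Γ'  ∎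

mainTheorem7 : ∀ (Φ : List (IVar × Ty × Ty)) (ω : Iso) (T : ITy) →
    isoCtx Φ ⊢ω ω ∶ T → isoCtxInv Φ ⊢ω inv ω ∶ invT T
mainTheorem7 Φ ω T ⊢ω = subst (λ Ψ → Ψ ⊢ω inv ω ∶ invT T) (invCtx-isoCtx Φ) (⊢ω-inv ω ⊢ω)
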